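{- Let $\mathbf A$ be a modular pseudo-Kleene lattice and $x,y\in A$. The following are equivalent: (1) $x\,\mathrm C\,y$; (2) $y\,\mathrm C\,x$; (3) $x\,\mathrm C\,y'$; (4) $x'\,\mathrm C\,y$; (5) $x\,\mathrm C\,y$ and $(x\lor x')\land(y\lor y')=((x\lor x')\land y)\lor((x\lor x')\land y')$.
   Context: A pseudo-Kleene lattice is an algebra $(A,\land,\lor,{}',0,1)$ with $(A,\land,\lor,0,1)$ a bounded lattice, ${}'$ an antitone involution, and $x\land x'\leq y\lor y'$; it is modular if its lattice reduct is modular. For $a,b\in A$, $a\,\mathrm C\,b$ means: (C1) $a\land(b\lor b')=(a\land b)\lor(a\land b')$; (C2) $b\land(a\lor a')=(b\land a)\lor(b\land a')$; (C3) $a\land a'=((a\land a')\land b)\lor((a\land a')\land b')$. -}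

module Defs where

open import Level using (Level; _⊔_; suc)
open import Relation.Binary.Core using (Rel)
open import Algebra.Core using (Op₁; Op₂)
open import Algebra.Lattice.Structures using (IsLattice)
open import Data.Product using (_×_)
open import Function.Bundles using (_⇔_)

record ModularPseudoKleeneLattice (c ℓ : Level) : Set (suc (c ⊔ ℓ)) where
  infixr 7 _∧_
  infixr 6 _∨_
  infix  4 _≈_ _≤_
  field
    Carrier   : Set c
    _≈_       : Rel Carrier ℓ
    _∧_       : Op₂ Carrier
    _∨_       : Op₂ Carrier
    _′        : Op₁ Carrier
    𝟘         : Carrier
    𝟙         : Carrier
    isLattice : IsLattice _≈_ _∨_ _∧_

  _≤_ : Rel Carrier ℓ
  x ≤ y = (x ∧ y) ≈ x

  field
    𝟘-least    : ∀ x → 𝟘 ≤ x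
    𝟙-greatest : ∀ x → x ≤ 𝟙
    ′-cong     : ∀ {x y} → x ≈ y → (x ′) ≈ (y ′)
    ′-antitone : ∀ {x y} → x ≤ y → (y ′) ≤ (x ′)
    ′-involutive : ∀ x → ((x ′) ′) ≈ x
    kleene     : ∀ x y → (x ∧ (x ′)) ≤ (y ∨ (y ′))
    modular    : ∀ x y z → x ≤ z → (x ∨ (y ∧ z)) ≈ ((x ∨ y) ∧ z)

  open IsLattice isLattice public

  C1 : Carrier → Carrier → Set ℓ
  C1 a b = (a ∧ (b ∨ (b ′))) ≈ ((a ∧ b) ∨ (a ∧ (b ′)))

  C2 : Carrier → Carrier → Set ℓ
  C2 a b = (b ∧ (a ∨ (a ′))) ≈ ((b ∧ a) ∨ (b ∧ (a ′)))

  C3 : Carrier → Carrier → Set ℓ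
  C3 a b = (a ∧ (a ′)) ≈ (((a ∧ (a ′)) ∧ b) ∨ ((a ∧ (a ′)) ∧ (b ′)))

  _C_ : Carrier → Carrier → Set ℓ
  a C b = C1 a b × C2 a b × C3 a b

  Extra : Carrier → Carrier → Set ℓ
  Extra x y = ((x ∨ (x ′)) ∧ (y ∨ (y ′))) ≈ (((x ∨ (x ′)) ∧ y) ∨ ((x ∨ (x ′)) ∧ (y ′)))

TFAE5 : ∀ {a} (P₁ P₂ P₃ P₄ P₅ : Set a) → Set a
TFAE5 P₁ P₂ P₃ P₄ P₅ = (P₁ ⇔ P₂) × (P₁ ⇔ P₃) × (P₁ ⇔ P₄) × (P₁ ⇔ P₅)

{-# OPTIONS --safe #-}
module Submission where

-- Everything reduces to C1: C2 a b is C1 b a, the Kleene condition makes C3 a b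
-- equivalent to C1 (a ∧ a ′) b, and Extra x y is C1 (x ∨ x ′) y. C1 a b is
-- trivially preserved by b ↦ b ′, and by modularity also by a ↦ a ′: in a modular
-- lattice C1 a b is equivalent to (b ∨ a) ∧ (b ∨ b ′) ≤ b ∨ (b ′ ∧ a), and the
-- De Morgan dual of this inequality, after one more use of modularity, is the same
-- inequality for a ′. Symmetry of C then comes from expanding (y ∨ y ′) ∧ (x ∨ x ′) with
-- C1 (x ∨ x ′) y, C1 y x and C1 (y ′) x.

open import Defs
open import Data.Product using (_×_; _,_; proj₁)
open import Function.Base using (_∘_)
open import Function.Bundles using (_⇔_; mk⇔; module Equivalence)
open import Algebra.Lattice.Bundles using (Lattice)
import Algebra.Lattice.Properties.Lattice as LatticeProperties
import Relation.Binary.Lattice as OrderTheoretic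
import Relation.Binary.Lattice.Properties.JoinSemilattice as JoinSemilatticeProperties
import Relation.Binary.Lattice.Properties.MeetSemilattice as MeetSemilatticeProperties
import Relation.Binary.Reasoning.PartialOrder as PartialOrderReasoning

module ModularPseudoKleeneLatticeProperties {c ℓ} (A : ModularPseudoKleeneLattice c ℓ) where
  -- _≤_ is taken from the standard library (x ≈ x ∧ y); the record's is its sym.
  open ModularPseudoKleeneLattice A hiding (_≤_)

  lattice : Lattice c ℓ
  lattice = record { isLattice = isLattice }

  open LatticeProperties lattice using (poset; ∨-∧-orderTheoreticLattice)
  open OrderTheoretic.Lattice ∨-∧-orderTheoreticLattice
    using (_≤_; x≤x∨y; y≤x∨y; ∨-least; x∧y≤x; x∧y≤y; ∧-greatest; joinSemilattice; meetSemilattice)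
    renaming (refl to ≤-refl; trans to ≤-trans; antisym to ≤-antisym; reflexive to ≤-reflexive)
  open JoinSemilatticeProperties joinSemilattice using (∨-monotonic)
  open MeetSemilatticeProperties meetSemilattice using (∧-monotonic)
  open PartialOrderReasoning poset
  open Equivalence using (to; from)

  ′-antitonic : ∀ {x y} → x ≤ y → y ′ ≤ x ′
  ′-antitonic x≤y = sym (′-antitone (sym x≤y))

  ′-transpose : ∀ {x y} → x ≤ y ′ → y ≤ x ′
  ′-transpose {x} {y} x≤y′ = ≤-trans (≤-reflexive (sym (′-involutive y))) (′-antitonic x≤y′)

  modularity : ∀ {x z} y → x ≤ z → x ∨ (y ∧ z) ≈ (x ∨ y) ∧ z
  modularity y x≤z = modular _ y _ (sym x≤z)

  ∧′≤∨′ : ∀ x y → x ∧ x ′ ≤ y ∨ y ′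
  ∧′≤∨′ x y = sym (kleene x y)

  ′-∨ : ∀ x y → (x ∨ y) ′ ≈ x ′ ∧ y ′
  ′-∨ x y = ≤-antisym
    (∧-greatest (′-antitonic (x≤x∨y x y)) (′-antitonic (y≤x∨y x y)))
    (′-transpose (∨-least (′-transpose (x∧y≤x _ _)) (′-transpose (x∧y≤y _ _))))

  ′-∧ : ∀ x y → (x ∧ y) ′ ≈ x ′ ∨ y ′
  ′-∧ x y = begin-equality
    (x ∧ y) ′           ≈⟨ ′-cong (∧-cong (′-involutive x) (′-involutive y)) ⟨
    (x ′ ′ ∧ y ′ ′) ′   ≈⟨ ′-cong (′-∨ (x ′) (y ′)) ⟨
    (x ′ ∨ y ′) ′ ′     ≈⟨ ′-involutive _ ⟩
    x ′ ∨ y ′           ∎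

  ∧′-′ : ∀ x → (x ∧ x ′) ′ ≈ x ∨ x ′
  ∧′-′ x = trans (′-∧ x (x ′)) (trans (∨-congˡ (′-involutive x)) (∨-comm _ _))

  ∨′-′ : ∀ x → (x ∨ x ′) ′ ≈ x ∧ x ′
  ∨′-′ x = trans (′-∨ x (x ′)) (trans (∧-congˡ (′-involutive x)) (∧-comm _ _))

  modular-≤ : ∀ {r z t} → r ≤ z → z ≤ r ∨ t → t ∧ z ≤ r → z ≤ r
  modular-≤ {r} {z} {t} r≤z z≤r∨t t∧z≤r = begin
    z             ≤⟨ ∧-greatest z≤r∨t ≤-refl ⟩
    (r ∨ t) ∧ z   ≈⟨ modularity t r≤z ⟨
    r ∨ (t ∧ z)   ≤⟨ ∨-least ≤-refl t∧z≤r ⟩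
    r             ∎

  C1-≥ : ∀ a b → (a ∧ b) ∨ (a ∧ b ′) ≤ a ∧ (b ∨ b ′)
  C1-≥ a b = ∨-least (∧-monotonic ≤-refl (x≤x∨y _ _)) (∧-monotonic ≤-refl (y≤x∨y _ _))

  C1-from-≤ : ∀ {a b} → a ∧ (b ∨ b ′) ≤ (a ∧ b) ∨ (a ∧ b ′) → C1 a b
  C1-from-≤ {a} {b} h = ≤-antisym h (C1-≥ a b)

  C1-congˡ : ∀ {a a₂ b} → a ≈ a₂ → C1 a b → C1 a₂ b
  C1-congˡ a≈a₂ h = trans (∧-congʳ (sym a≈a₂)) (trans h (∨-cong (∧-congʳ a≈a₂) (∧-congʳ a≈a₂)))

  C1-congʳ : ∀ {a b b₂} → b ≈ b₂ → C1 a b → C1 a b₂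
  C1-congʳ b≈b₂ h = trans (∧-congˡ (∨-cong (sym b≈b₂) (′-cong (sym b≈b₂))))
    (trans h (∨-cong (∧-congˡ b≈b₂) (∧-congˡ (′-cong b≈b₂))))

  C1-′ʳ : ∀ {a b} → C1 a b → C1 a (b ′)
  C1-′ʳ {a} {b} h = begin-equality
    a ∧ (b ′ ∨ b ′ ′)         ≈⟨ ∧-congˡ (trans (∨-congˡ (′-involutive b)) (∨-comm _ _)) ⟩
    a ∧ (b ∨ b ′)             ≈⟨ h ⟩
    (a ∧ b) ∨ (a ∧ b ′)       ≈⟨ ∨-comm _ _ ⟩
    (a ∧ b ′) ∨ (a ∧ b)       ≈⟨ ∨-congˡ (∧-congˡ (′-involutive b)) ⟨
    (a ∧ b ′) ∨ (a ∧ b ′ ′)   ∎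

  C1ʲ : Carrier → Carrier → Set ℓ
  C1ʲ a b = (b ∨ a) ∧ (b ∨ b ′) ≤ b ∨ (b ′ ∧ a)

  C1⇒C1ʲ : ∀ {a b} → C1 a b → C1ʲ a b
  C1⇒C1ʲ {a} {b} h = begin
    (b ∨ a) ∧ (b ∨ b ′)           ≈⟨ modularity a (x≤x∨y b (b ′)) ⟨
    b ∨ (a ∧ (b ∨ b ′))           ≈⟨ ∨-congˡ h ⟩
    b ∨ ((a ∧ b) ∨ (a ∧ b ′))     ≤⟨ ∨-monotonic ≤-refl (∨-least (≤-trans (x∧y≤y _ _) (x≤x∨y _ _))
                                                                 (≤-trans (≤-reflexive (∧-comm _ _)) (y≤x∨y _ _))) ⟩
    b ∨ (b ∨ (b ′ ∧ a))           ≤⟨ ∨-least (x≤x∨y _ _) ≤-refl ⟩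
    b ∨ (b ′ ∧ a)                 ∎

  C1ʲ⇒C1 : ∀ {a b} → C1ʲ a b → C1 a b
  C1ʲ⇒C1 {a} {b} h = C1-from-≤ (modular-≤ (C1-≥ a b) a∧M≤r∨b b∧a∧M≤r)
    where
    r≤r∨b : (a ∧ b) ∨ (a ∧ b ′) ≤ ((a ∧ b) ∨ (a ∧ b ′)) ∨ b
    r≤r∨b = x≤x∨y _ _

    a∧M≤r∨b : a ∧ (b ∨ b ′) ≤ ((a ∧ b) ∨ (a ∧ b ′)) ∨ b
    a∧M≤r∨b = begin
      a ∧ (b ∨ b ′)                   ≤⟨ ∧-monotonic (y≤x∨y b a) ≤-refl ⟩
      (b ∨ a) ∧ (b ∨ b ′)             ≤⟨ h ⟩
      b ∨ (b ′ ∧ a)                   ≤⟨ ∨-least (y≤x∨y _ _) (≤-trans (≤-reflexive (∧-comm _ _)) (≤-trans (y≤x∨y _ _) r≤r∨b)) ⟩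
      ((a ∧ b) ∨ (a ∧ b ′)) ∨ b       ∎

    b∧a∧M≤r : b ∧ (a ∧ (b ∨ b ′)) ≤ (a ∧ b) ∨ (a ∧ b ′)
    b∧a∧M≤r = ≤-trans (∧-greatest (≤-trans (x∧y≤y _ _) (x∧y≤x _ _)) (x∧y≤x _ _)) (x≤x∨y _ _)

  C1ʲ-′ : ∀ {a b} → C1ʲ a b → C1ʲ (a ′) b
  C1ʲ-′ {a} {b} h = begin
    (b ∨ a ′) ∧ (b ∨ b ′)           ≈⟨ ∧-comm _ _ ⟩
    (b ∨ b ′) ∧ (b ∨ a ′)           ≈⟨ modularity (b ′) (x≤x∨y b (a ′)) ⟨
    b ∨ (b ′ ∧ (b ∨ a ′))           ≤⟨ ∨-monotonic ≤-refl complemented ⟩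
    b ∨ ((b ′ ∧ a ′) ∨ (b ′ ∧ b))   ≤⟨ ∨-least (x≤x∨y _ _) (∨-least (y≤x∨y _ _) (≤-trans (x∧y≤y _ _) (x≤x∨y _ _))) ⟩
    b ∨ (b ′ ∧ a ′)                 ∎
    where
    complemented : b ′ ∧ (b ∨ a ′) ≤ (b ′ ∧ a ′) ∨ (b ′ ∧ b)
    complemented = begin
      b ′ ∧ (b ∨ a ′)                 ≈⟨ trans (′-∨ _ _) (∧-congˡ (trans (′-∧ _ _) (∨-congʳ (′-involutive b)))) ⟨
      (b ∨ (b ′ ∧ a)) ′               ≤⟨ ′-antitonic h ⟩
      ((b ∨ a) ∧ (b ∨ b ′)) ′         ≈⟨ trans (′-∧ _ _) (∨-cong (′-∨ _ _) (trans (′-∨ _ _) (∧-congˡ (′-involutive b)))) ⟩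
      (b ′ ∧ a ′) ∨ (b ′ ∧ b)         ∎

  C1-′ˡ : ∀ {a b} → C1 a b → C1 (a ′) b
  C1-′ˡ = C1ʲ⇒C1 ∘ C1ʲ-′ ∘ C1⇒C1ʲ

  C3⇔C1-∧′ : ∀ {a b} → C3 a b ⇔ C1 (a ∧ a ′) b
  C3⇔C1-∧′ {a} {b} = mk⇔ (trans (sym (∧′≤∨′ a b))) (trans (∧′≤∨′ a b))

  C3⇒C1-∨′ : ∀ {a b} → C3 a b → C1 (a ∨ a ′) b
  C3⇒C1-∨′ {a} = C1-congˡ (∧′-′ a) ∘ C1-′ˡ ∘ to C3⇔C1-∧′

  C1-∨′⇒C3 : ∀ {a b} → C1 (a ∨ a ′) b → C3 a b
  C1-∨′⇒C3 {a} = from C3⇔C1-∧′ ∘ C1-congˡ (∨′-′ a) ∘ C1-′ˡ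

  C1-∨′-transpose : ∀ {x y} → C1 (x ∨ x ′) y → C1 y x → C1 (y ′) x → C1 (y ∨ y ′) x
  C1-∨′-transpose {x} {y} hxy hyx hy′x = C1-from-≤ (begin
    (y ∨ y ′) ∧ (x ∨ x ′)                                 ≈⟨ ∧-comm _ _ ⟩
    (x ∨ x ′) ∧ (y ∨ y ′)                                 ≈⟨ hxy ⟩
    ((x ∨ x ′) ∧ y) ∨ ((x ∨ x ′) ∧ y ′)                   ≈⟨ ∨-cong (∧-comm _ _) (∧-comm _ _) ⟩
    (y ∧ (x ∨ x ′)) ∨ (y ′ ∧ (x ∨ x ′))                   ≈⟨ ∨-cong hyx hy′x ⟩
    ((y ∧ x) ∨ (y ∧ x ′)) ∨ ((y ′ ∧ x) ∨ (y ′ ∧ x ′))     ≤⟨ ∨-least (∨-monotonic (∧≤∧ y≤My) (∧≤∧ y≤My)) (∨-monotonic (∧≤∧ y′≤My) (∧≤∧ y′≤My)) ⟩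
    ((y ∨ y ′) ∧ x) ∨ ((y ∨ y ′) ∧ x ′)                   ∎)
    where
    y≤My = x≤x∨y y (y ′)
    y′≤My = y≤x∨y y (y ′)
    ∧≤∧ : ∀ {u v w} → u ≤ v → u ∧ w ≤ v ∧ w
    ∧≤∧ u≤v = ∧-monotonic u≤v ≤-refl

  C⇒Extra : ∀ {x y} → x C y → Extra x y
  C⇒Extra (_ , _ , c3) = C3⇒C1-∨′ c3

  C-sym : ∀ {x y} → x C y → y C x
  C-sym (c1 , c2 , c3) = c2 , c1 , C1-∨′⇒C3 (C1-∨′-transpose (C3⇒C1-∨′ c3) c2 (C1-′ˡ c2))

  C-′ʳ : ∀ {x y} → x C y → x C (y ′)
  C-′ʳ (c1 , c2 , c3) = C1-′ʳ c1 , C1-′ˡ c2 , from C3⇔C1-∧′ (C1-′ʳ (to C3⇔C1-∧′ c3))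

  C-′ˡ : ∀ {x y} → x C y → (x ′) C y
  C-′ˡ {x} (c1 , c2 , c3) = C1-′ˡ c1 , C1-′ʳ c2 ,
    from C3⇔C1-∧′ (C1-congˡ (trans (∧-comm _ _) (∧-congˡ (sym (′-involutive x)))) (to C3⇔C1-∧′ c3))

  C-congˡ : ∀ {x x₂ y} → x ≈ x₂ → x C y → x₂ C y
  C-congˡ x≈x₂ (c1 , c2 , c3) = C1-congˡ x≈x₂ c1 , C1-congʳ x≈x₂ c2 ,
    from C3⇔C1-∧′ (C1-congˡ (∧-cong x≈x₂ (′-cong x≈x₂)) (to C3⇔C1-∧′ c3))

  C-congʳ : ∀ {x y y₂} → y ≈ y₂ → x C y → x C y₂
  C-congʳ y≈y₂ (c1 , c2 , c3) = C1-congʳ y≈y₂ c1 , C1-congˡ y≈y₂ c2 ,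
    from C3⇔C1-∧′ (C1-congʳ y≈y₂ (to C3⇔C1-∧′ c3))

lemma4p13 : ∀ {c ℓ} (A : ModularPseudoKleeneLattice c ℓ) →
    let open ModularPseudoKleeneLattice A in
    ∀ x y → TFAE5 (x C y) (y C x) (x C (y ′)) ((x ′) C y) ((x C y) × Extra x y)
lemma4p13 A x y =
  mk⇔ C-sym C-sym ,
  mk⇔ C-′ʳ (C-congʳ (′-involutive y) ∘ C-′ʳ) ,
  mk⇔ C-′ˡ (C-congˡ (′-involutive x) ∘ C-′ˡ) ,
  mk⇔ (λ h → h , C⇒Extra h) proj₁
  where
  open ModularPseudoKleeneLattice A
  open ModularPseudoKleeneLatticeProperties A
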